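{- Let $d,k\ge 2$ be integers and let $G$ be a minimal $(d,k;+1)$-digraph. Then the vertices of $G$ have at most three distinct orders under the outlier function, and if $G$ has three distinct vertex orders $s_1<s_2<s_3$, then $s_1=2$ and $s_2=k+2$.
   Context: A digraph has no loops and no multiple arcs. $G$ is $k$-geodetic if for any $u,v$ there is at most one directed $u,v$-walk of length at most $k$. $M(d,k)=1+d+\cdots+d^k$. A $(d,k;+1)$-digraph is a $k$-geodetic digraph with minimum out-degree $d$ and order $M(d,k)+1$. In such a digraph, for each vertex $u$ there is a unique vertex $o(u)$ whose distance from $u$ exceeds $k$; the outlier function $o$ is a fixed-point-free digraph automorphism. The order of a vertex $v$ is the least positive integer $t$ with $o^t(v)=v$. A $(d,k;+1)$-digraph is minimal if there is no $(d',k;+1)$-digraph for any $d'$ with $2\le d'<d$. -}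

module Defs where

open import Data.Nat using (ℕ; zero; suc; _+_; _^_; _≤_; _<_)
open import Data.Bool using (Bool; true; false; if_then_else_)
open import Data.Fin using (Fin)
open import Data.List using (List; map; allFin)
open import Data.Nat.ListAction using (sum)
open import Data.Product using (Σ; _×_; _,_; ∃)
open import Relation.Binary.PropositionalEquality using (_≡_; _≢_)
open import Relation.Nullary using (¬_)
open import Function using (_∘_)

-- A digraph on the vertex set Fin n, given by a Boolean adjacency matrix
-- (so there are no multiple arcs); loops are excluded by `Loopless`.
Adj : ℕ → Set
Adj n = Fin n → Fin n → Bool

Loopless : ∀ {n} → Adj n → Set
Loopless {n} A = ∀ (v : Fin n) → A v v ≡ false

outdeg : ∀ {n} → Adj n → Fin n → ℕ
outdeg {n} A v = sum (map (λ w → if A v w then 1 else 0) (allFin n))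

data Walk {n} (A : Adj n) : Fin n → Fin n → ℕ → Set where
  here : ∀ v → Walk A v v 0
  step : ∀ {u w v ℓ} → A u w ≡ true → Walk A w v ℓ → Walk A u v (suc ℓ)

Geodetic : ∀ {n} → ℕ → Adj n → Set
Geodetic {n} k A = ∀ (u v : Fin n) (ℓ₁ ℓ₂ : ℕ)
  (p : Walk A u v ℓ₁) (q : Walk A u v ℓ₂) → ℓ₁ ≤ k → ℓ₂ ≤ k →
  _≡_ {A = Σ ℕ (Walk A u v)} (ℓ₁ , p) (ℓ₂ , q)

M : ℕ → ℕ → ℕ
M d zero = 1
M d (suc k) = M d k + d ^ suc k

record IsPlusOne (d k : ℕ) (A : Adj (suc (M d k))) : Set where
  field
    loopless  : Loopless A
    geodetic  : Geodetic k A
    minOutdeg : ∀ v → d ≤ outdeg A v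

Reach : ∀ {n} → Adj n → ℕ → Fin n → Fin n → Set
Reach A k u v = ∃ λ ℓ → ℓ ≤ k × Walk A u v ℓ

IsOutlier : ∀ {n} → Adj n → ℕ → (Fin n → Fin n) → Set
IsOutlier {n} A k o = ∀ (u : Fin n) →
  ¬ Reach A k u (o u) × (∀ v → ¬ Reach A k u v → v ≡ o u)

iter : ∀ {X : Set} → (X → X) → ℕ → X → X
iter f zero x = x
iter f (suc t) x = f (iter f t x)

IsOrder : ∀ {n} → (Fin n → Fin n) → Fin n → ℕ → Set
IsOrder o v t = 0 < t × iter o t v ≡ v × (∀ t' → 0 < t' → t' < t → iter o t' v ≢ v)

Minimal : ℕ → ℕ → Set
Minimal d k = ∀ d' → 2 ≤ d' → d' < d → ¬ (Σ (Adj (suc (M d' k))) (IsPlusOne d' k))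

{-# OPTIONS --safe #-}
module Submission where

-- Let a be the adjacency matrix of G, S = I + a + ⋯ + aᵏ, and P the matrix of the outlier map
-- (P u v = 1 iff v = o u).  k-geodecity and the outlier property say exactly that S + P = J, and a
-- commutes with S, so comparing a(S + P) with (S + P)a gives, for all vertices u and v,
--   indeg v + #{w ∈ N⁺(u) | o w = v} = d + [o u → v].
-- If some in-degree exceeds d, every o u is an in-neighbour of that vertex; then the images of o
-- are pairwise non-adjacent (k ≥ 2) and share their out-neighbourhoods, which forces o (o x) = x on
-- the image of o, so every order is 2.  Otherwise G is diregular and o is an automorphism.  For a
-- vertex x₀ of order t, the same counting applied to the subdigraph induced on the fixed points of
-- oᵗ shows that it is a (d′,k;+1)-digraph with d′ ≤ d, and minimality leaves d′ ∈ {0, 1, d}.  For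
-- d′ = 0 no arc joins two fixed points, so o (o x₀) = x₀ and t = 2; for d′ = 1 it is a directed
-- (k+2)-cycle on which o steps backwards, so t = k + 2; for d′ = d it is all of G, so oᵗ = id and
-- t is the largest order.  Hence every order other than the largest one is 2 or k + 2.

import Algebra.Properties.CommutativeSemigroup as CommutativeSemigroupProperties
open import Axiom.UniquenessOfIdentityProofs using (module Decidable⇒UIP)
open import Data.Bool as Bool using (Bool; true; false; if_then_else_)
open import Data.Empty using (⊥; ⊥-elim)
open import Data.Fin using (Fin; zero; suc)
open import Data.Fin.Properties using (all?; ¬∀⟶∃¬) renaming (suc-injective to suc-injectiveᶠ; _≟_ to _≟ᶠ_)
import Data.List.Base as List
import Data.List.Properties as List
open import Data.Nat using (ℕ; zero; suc; pred; _+_; _*_; _^_; _≤_; _<_; _≤?_; z≤n; s≤s; >-nonZero)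
import Data.Nat.ListAction as Listℕ
open import Data.Nat.Properties
open import Data.Product using (Σ; ∃; _×_; _,_; proj₁; proj₂)
open import Data.Sum using (_⊎_; inj₁; inj₂)
open import Function using (_∘_; id)
open import Function.Definitions using (Injective)
open import Level using (0ℓ)
open import Relation.Binary.Definitions using (tri<; tri≈; tri>)
open import Relation.Binary.PropositionalEquality
open import Relation.Nullary using (¬_; Dec; does; yes; no)
open import Relation.Unary using (Pred; Decidable)

open import Defs

open import Algebra.Properties.Semiring.Sum +-*-semiring
  using (sum; sum-cong-≗; sum-replicate-zero; ∑-distrib-+; ∑-comm; *-distribˡ-sum; *-distribʳ-sum)

module +-CS = CommutativeSemigroupProperties +-commutativeSemigroup
module *-CS = CommutativeSemigroupProperties *-commutativeSemigroup

fromBool : Bool → ℕ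
fromBool b = if b then 1 else 0

fromBool≤1 : ∀ b → fromBool b ≤ 1
fromBool≤1 true  = s≤s z≤n
fromBool≤1 false = z≤n

fromBool-pos : ∀ {b} → 0 < fromBool b → b ≡ true
fromBool-pos {true} _ = refl

+-pos⁻ : ∀ m {n} → 0 < m + n → 0 < m ⊎ 0 < n
+-pos⁻ zero    0<n = inj₂ 0<n
+-pos⁻ (suc m) _   = inj₁ (s≤s z≤n)

*-pos⁻ : ∀ m {n} → 0 < m * n → 0 < m × 0 < n
*-pos⁻ (suc m) {suc n} _   = s≤s z≤n , s≤s z≤n
*-pos⁻ (suc m) {zero}  0<0 = ⊥-elim (<-irrefl (sym (*-zeroʳ m)) 0<0)

m+n≤1 : ∀ {m n} → m ≤ 1 → n ≤ 1 → (0 < m → 0 < n → ⊥) → m + n ≤ 1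
m+n≤1 {zero}          _   n≤1 _    = n≤1
m+n≤1 {suc m} {zero}  m≤1 _   _    = subst (_≤ 1) (sym (+-identityʳ (suc m))) m≤1
m+n≤1 {suc m} {suc n} _   _   both = ⊥-elim (both (s≤s z≤n) (s≤s z≤n))

cancel-complements : ∀ {x y s w z p} → x + y ≡ s + w → x + z ≡ 1 → s + p ≡ 1 → w + z ≡ y + p
cancel-complements {x} {y} {s} {w} {z} {p} x+y≡s+w x+z≡1 s+p≡1 = +-cancelˡ-≡ 1 _ _ (begin
  1 + (w + z)          ≡⟨ cong (_+ (w + z)) s+p≡1 ⟨
  s + p + (w + z)      ≡⟨ +-CS.interchange s p w z ⟩
  s + w + (p + z)      ≡⟨ cong₂ _+_ x+y≡s+w (+-comm z p) ⟨
  x + y + (z + p)      ≡⟨ +-CS.interchange x y z p ⟩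
  x + z + (y + p)      ≡⟨ cong (_+ (y + p)) x+z≡1 ⟩
  1 + (y + p)          ∎)
  where open ≡-Reasoning

<-on-two-values : ∀ {m n p q : ℕ} → m ≡ p ⊎ m ≡ q → n ≡ p ⊎ n ≡ q → p ≤ q → m < n → m ≡ p × n ≡ q
<-on-two-values (inj₁ m≡p)  (inj₂ n≡q)  _   _   = m≡p , n≡q
<-on-two-values (inj₁ refl) (inj₁ refl) _   m<n = ⊥-elim (<-irrefl refl m<n)
<-on-two-values (inj₂ refl) (inj₂ refl) _   m<n = ⊥-elim (<-irrefl refl m<n)
<-on-two-values (inj₂ refl) (inj₁ refl) p≤q m<n = ⊥-elim (<⇒≱ m<n p≤q)

M-suc : ∀ c j → M c (suc j) ≡ 1 + c * M c j
M-suc c zero    = cong suc (trans (*-identityʳ c) (sym (*-identityʳ c)))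
M-suc c (suc j) = begin
  M c (suc j) + c ^ suc (suc j)    ≡⟨ cong (_+ c ^ suc (suc j)) (M-suc c j) ⟩
  1 + c * M c j + c * c ^ suc j    ≡⟨ +-assoc 1 (c * M c j) _ ⟩
  1 + (c * M c j + c * c ^ suc j)  ≡⟨ cong (1 +_) (*-distribˡ-+ c (M c j) _) ⟨
  1 + c * (M c j + c ^ suc j)      ∎
  where open ≡-Reasoning

M>0 : ∀ c j → 0 < M c j
M>0 c zero    = s≤s z≤n
M>0 c (suc j) = ≤-trans (M>0 c j) (m≤m+n _ _)

δ : ∀ {n} → Fin n → Fin n → ℕ
δ x y = fromBool (does (x ≟ᶠ y))

δ-refl : ∀ {n} (x : Fin n) → δ x x ≡ 1
δ-refl x with x ≟ᶠ x
... | yes _   = refl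
... | no x≢x = ⊥-elim (x≢x refl)

δ-≢ : ∀ {n} {x y : Fin n} → x ≢ y → δ x y ≡ 0
δ-≢ {x = x} {y} x≢y with x ≟ᶠ y
... | yes x≡y = ⊥-elim (x≢y x≡y)
... | no _    = refl

δ-pos : ∀ {n} {x y : Fin n} → 0 < δ x y → x ≡ y
δ-pos {x = x} {y} _ with x ≟ᶠ y
... | yes x≡y = x≡y

δ≤1 : ∀ {n} (x y : Fin n) → δ x y ≤ 1
δ≤1 x y = fromBool≤1 (does (x ≟ᶠ y))

sum-mono-≤ : ∀ {n} {f g : Fin n → ℕ} → (∀ i → f i ≤ g i) → sum f ≤ sum g
sum-mono-≤ {zero}  _   = z≤n
sum-mono-≤ {suc n} f≤g = +-mono-≤ (f≤g zero) (sum-mono-≤ (f≤g ∘ suc))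

sum-const : ∀ n c → sum {n} (λ _ → c) ≡ n * c
sum-const zero    c = refl
sum-const (suc n) c = cong (c +_) (sum-const n c)

sum-zero : ∀ {n} {f : Fin n → ℕ} → (∀ i → f i ≡ 0) → sum f ≡ 0
sum-zero {n} f≡0 = trans (sum-cong-≗ f≡0) (sum-replicate-zero n)

sum-only : ∀ {n} (f : Fin n → ℕ) i → (∀ j → j ≢ i → f j ≡ 0) → sum f ≡ f i
sum-only f zero    rest = trans (cong (f zero +_) (sum-zero (λ j → rest (suc j) λ ()))) (+-identityʳ (f zero))
sum-only f (suc i) rest = trans (cong (_+ sum (f ∘ suc)) (rest zero λ ()))
                                (sum-only (f ∘ suc) i (λ j j≢i → rest (suc j) (j≢i ∘ suc-injectiveᶠ)))

sum-δˡ : ∀ {n} i (f : Fin n → ℕ) → sum (λ j → δ i j * f j) ≡ f i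
sum-δˡ i f = trans (sum-only _ i (λ j j≢i → cong (_* f j) (δ-≢ (j≢i ∘ sym))))
                   (trans (cong (_* f i) (δ-refl i)) (+-identityʳ (f i)))

sum-δʳ : ∀ {n} i (f : Fin n → ℕ) → sum (λ j → f j * δ j i) ≡ f i
sum-δʳ i f = trans (sum-only _ i (λ j j≢i → trans (cong (f j *_) (δ-≢ j≢i)) (*-zeroʳ (f j))))
                   (trans (cong (f i *_) (δ-refl i)) (*-identityʳ (f i)))

term≤sum : ∀ {n} (f : Fin n → ℕ) i → f i ≤ sum f
term≤sum f zero    = m≤m+n (f zero) _
term≤sum f (suc i) = ≤-trans (term≤sum (f ∘ suc) i) (m≤n+m _ (f zero))

two-terms≤sum : ∀ {n} (f : Fin n → ℕ) {i j} → i ≢ j → f i + f j ≤ sum f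
two-terms≤sum f {zero}  {zero}  i≢j = ⊥-elim (i≢j refl)
two-terms≤sum f {zero}  {suc j} _   = +-monoʳ-≤ (f zero) (term≤sum (f ∘ suc) j)
two-terms≤sum f {suc i} {zero}  _   =
  subst (_≤ sum f) (+-comm (f zero) (f (suc i))) (+-monoʳ-≤ (f zero) (term≤sum (f ∘ suc) i))
two-terms≤sum f {suc i} {suc j} i≢j = ≤-trans (two-terms≤sum (f ∘ suc) (i≢j ∘ cong suc)) (m≤n+m _ (f zero))

0<sum⇒0<term : ∀ {n} (f : Fin n → ℕ) → 0 < sum f → ∃ λ i → 0 < f i
0<sum⇒0<term {suc n} f 0<Σ with +-pos⁻ (f zero) 0<Σ
... | inj₁ 0<f₀ = zero , 0<f₀
... | inj₂ 0<Σ′ = let (i , 0<fᵢ) = 0<sum⇒0<term (f ∘ suc) 0<Σ′ in suc i , 0<fᵢ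

sum≤1 : ∀ {n} (f : Fin n → ℕ) → (∀ i → f i ≤ 1) → (∀ i j → 0 < f i → 0 < f j → i ≡ j) → sum f ≤ 1
sum≤1 {zero}  f _   _      = z≤n
sum≤1 {suc n} f f≤1 unique = m+n≤1 (f≤1 zero) (sum≤1 (f ∘ suc) (f≤1 ∘ suc) unique-rest) clash
  where
  unique-rest : ∀ i j → 0 < f (suc i) → 0 < f (suc j) → i ≡ j
  unique-rest i j p q = suc-injectiveᶠ (unique (suc i) (suc j) p q)
  clash : 0 < f zero → 0 < sum (f ∘ suc) → ⊥
  clash p q with 0<sum⇒0<term (f ∘ suc) q
  ... | i , r with unique zero (suc i) p r
  ... | ()

pointwise≤∧sum≥⇒pointwise≡ : ∀ {n} {f g : Fin n → ℕ} → (∀ i → f i ≤ g i) → sum g ≤ sum f →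
                             ∀ i → f i ≡ g i
pointwise≤∧sum≥⇒pointwise≡ {suc n} {f} f≤g Σg≤Σf zero =
  ≤-antisym (f≤g zero) (+-cancelʳ-≤ _ _ _ (≤-trans Σg≤Σf (+-monoʳ-≤ (f zero) (sum-mono-≤ (f≤g ∘ suc)))))
pointwise≤∧sum≥⇒pointwise≡ {suc n} {g = g} f≤g Σg≤Σf (suc i) =
  pointwise≤∧sum≥⇒pointwise≡ (f≤g ∘ suc) (+-cancelˡ-≤ (g zero) _ _ (≤-trans Σg≤Σf (+-monoˡ-≤ _ (f≤g zero)))) i

-- Matrices over ℕ

Matrix : ℕ → Set
Matrix n = Fin n → Fin n → ℕ

infix  4 _≐_
infixl 6 _⊕_
infixl 7 _⊙_

_≐_ : ∀ {n} → Matrix n → Matrix n → Set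
g ≐ h = ∀ u v → g u v ≡ h u v

I : ∀ {n} → Matrix n
I = δ

_⊕_ : ∀ {n} → Matrix n → Matrix n → Matrix n
(g ⊕ h) u v = g u v + h u v

_⊙_ : ∀ {n} → Matrix n → Matrix n → Matrix n
(g ⊙ h) u v = sum (λ w → g u w * h w v)

pow : ∀ {n} → Matrix n → ℕ → Matrix n
pow g zero    = I
pow g (suc i) = g ⊙ pow g i

powSum : ∀ {n} → Matrix n → ℕ → Matrix n
powSum g zero    = I
powSum g (suc j) = powSum g j ⊕ pow g (suc j)

rowSum : ∀ {n} → Matrix n → Fin n → ℕ
rowSum g u = sum (g u)

colSum : ∀ {n} → Matrix n → Fin n → ℕ
colSum g v = sum (λ w → g w v)

module _ {n : ℕ} where

  ⊙-congˡ : (g : Matrix n) {h h′ : Matrix n} → h ≐ h′ → g ⊙ h ≐ g ⊙ h′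
  ⊙-congˡ g h≐h′ u v = sum-cong-≗ (λ w → cong (g u w *_) (h≐h′ w v))

  ⊙-identityˡ : (g : Matrix n) → I ⊙ g ≐ g
  ⊙-identityˡ g u v = sum-δˡ u (λ w → g w v)

  ⊙-identityʳ : (g : Matrix n) → g ⊙ I ≐ g
  ⊙-identityʳ g u v = sum-δʳ v (g u)

  ⊙-assoc : (g h l : Matrix n) → (g ⊙ h) ⊙ l ≐ g ⊙ (h ⊙ l)
  ⊙-assoc g h l u v = begin
    sum (λ w → sum (λ x → g u x * h x w) * l w v)
      ≡⟨ sum-cong-≗ (λ w → *-distribʳ-sum (l w v) (λ x → g u x * h x w)) ⟩
    sum (λ w → sum (λ x → g u x * h x w * l w v))
      ≡⟨ ∑-comm (λ w x → g u x * h x w * l w v) ⟩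
    sum (λ x → sum (λ w → g u x * h x w * l w v))
      ≡⟨ sum-cong-≗ (λ x → sum-cong-≗ (λ w → *-assoc (g u x) (h x w) (l w v))) ⟩
    sum (λ x → sum (λ w → g u x * (h x w * l w v)))
      ≡⟨ sum-cong-≗ (λ x → *-distribˡ-sum (g u x) (λ w → h x w * l w v)) ⟨
    sum (λ x → g u x * sum (λ w → h x w * l w v))
      ∎
    where open ≡-Reasoning

  ⊙-distribˡ-⊕ : (g h l : Matrix n) → g ⊙ (h ⊕ l) ≐ g ⊙ h ⊕ g ⊙ l
  ⊙-distribˡ-⊕ g h l u v = trans (sum-cong-≗ (λ w → *-distribˡ-+ (g u w) (h w v) (l w v)))
                                 (∑-distrib-+ (λ w → g u w * h w v) (λ w → g u w * l w v))

  ⊙-distribʳ-⊕ : (g h l : Matrix n) → (h ⊕ l) ⊙ g ≐ h ⊙ g ⊕ l ⊙ g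
  ⊙-distribʳ-⊕ g h l u v = trans (sum-cong-≗ (λ w → *-distribʳ-+ (g w v) (h u w) (l u w)))
                                 (∑-distrib-+ (λ w → h u w * g w v) (λ w → l u w * g w v))

  pow-comm : (g : Matrix n) (i : ℕ) → g ⊙ pow g i ≐ pow g i ⊙ g
  pow-comm g zero    u v = trans (⊙-identityʳ g u v) (sym (⊙-identityˡ g u v))
  pow-comm g (suc i) u v = trans (⊙-congˡ g (pow-comm g i) u v) (sym (⊙-assoc g (pow g i) g u v))

  powSum-comm : (g : Matrix n) (j : ℕ) → g ⊙ powSum g j ≐ powSum g j ⊙ g
  powSum-comm g zero    = pow-comm g zero
  powSum-comm g (suc j) u v = begin
    (g ⊙ (powSum g j ⊕ pow g (suc j))) u v            ≡⟨ ⊙-distribˡ-⊕ g (powSum g j) (pow g (suc j)) u v ⟩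
    (g ⊙ powSum g j) u v + (g ⊙ pow g (suc j)) u v    ≡⟨ cong₂ _+_ (powSum-comm g j u v) (pow-comm g (suc j) u v) ⟩
    (powSum g j ⊙ g) u v + (pow g (suc j) ⊙ g) u v    ≡⟨ ⊙-distribʳ-⊕ g (powSum g j) (pow g (suc j)) u v ⟨
    ((powSum g j ⊕ pow g (suc j)) ⊙ g) u v            ∎
    where open ≡-Reasoning

  powSum-suc : (g : Matrix n) (j : ℕ) → powSum g (suc j) ≐ I ⊕ g ⊙ powSum g j
  powSum-suc g zero    u v = refl
  powSum-suc g (suc j) u v = begin
    powSum g (suc j) u v + pow g (suc (suc j)) u v
      ≡⟨ cong (_+ pow g (suc (suc j)) u v) (powSum-suc g j u v) ⟩
    I u v + (g ⊙ powSum g j) u v + (g ⊙ pow g (suc j)) u v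
      ≡⟨ +-assoc (I u v) _ _ ⟩
    I u v + ((g ⊙ powSum g j) u v + (g ⊙ pow g (suc j)) u v)
      ≡⟨ cong (I u v +_) (⊙-distribˡ-⊕ g (powSum g j) (pow g (suc j)) u v) ⟨
    I u v + (g ⊙ powSum g (suc j)) u v
      ∎
    where open ≡-Reasoning

  outlier-balance : (g S P : Matrix n) → g ⊙ S ≐ S ⊙ g →
                    ∀ u v → (g ⊙ (S ⊕ P)) u v + (P ⊙ g) u v ≡ ((S ⊕ P) ⊙ g) u v + (g ⊙ P) u v
  outlier-balance g S P gS≐Sg u v = begin
    (g ⊙ (S ⊕ P)) u v + (P ⊙ g) u v              ≡⟨ cong (_+ (P ⊙ g) u v) (⊙-distribˡ-⊕ g S P u v) ⟩
    (g ⊙ S) u v + (g ⊙ P) u v + (P ⊙ g) u v      ≡⟨ cong (λ x → x + (g ⊙ P) u v + (P ⊙ g) u v) (gS≐Sg u v) ⟩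
    (S ⊙ g) u v + (g ⊙ P) u v + (P ⊙ g) u v      ≡⟨ +-CS.xy∙z≈xz∙y ((S ⊙ g) u v) _ _ ⟩
    (S ⊙ g) u v + (P ⊙ g) u v + (g ⊙ P) u v      ≡⟨ cong (_+ (g ⊙ P) u v) (⊙-distribʳ-⊕ g S P u v) ⟨
    ((S ⊕ P) ⊙ g) u v + (g ⊙ P) u v              ∎
    where open ≡-Reasoning

  pow-mono-≤ : {g h : Matrix n} → (∀ u w → g u w ≤ h u w) → ∀ i u v → pow g i u v ≤ pow h i u v
  pow-mono-≤ g≤h zero    u v = ≤-refl
  pow-mono-≤ g≤h (suc i) u v = sum-mono-≤ (λ w → *-mono-≤ (g≤h u w) (pow-mono-≤ g≤h i w v))

  pow≤powSum : (g : Matrix n) {i j : ℕ} → i ≤ j → ∀ u v → pow g i u v ≤ powSum g j u v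
  pow≤powSum g {j = zero}  z≤n   u v = ≤-refl
  pow≤powSum g {i} {suc j} i≤1+j u v with m≤n⇒m<n∨m≡n i≤1+j
  ... | inj₁ i<1+j = ≤-trans (pow≤powSum g (≤-pred i<1+j) u v) (m≤m+n _ _)
  ... | inj₂ refl  = m≤n+m _ _

  rowSum-I : (u : Fin n) → rowSum I u ≡ 1
  rowSum-I u = trans (sum-cong-≗ (λ v → sym (*-identityʳ (δ u v)))) (sum-δˡ u (λ _ → 1))

  rowSum-⊙ : (g h : Matrix n) (u : Fin n) → rowSum (g ⊙ h) u ≡ sum (λ w → g u w * rowSum h w)
  rowSum-⊙ g h u = trans (∑-comm (λ v w → g u w * h w v))
                         (sum-cong-≗ (λ w → sym (*-distribˡ-sum (g u w) (h w))))

module _ {n : ℕ} (g : Matrix n) {c : ℕ} (c≤rowSum : ∀ w → c ≤ rowSum g w) where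

  ^≤rowSum-pow : ∀ i u → c ^ i ≤ rowSum (pow g i) u
  ^≤rowSum-pow zero    u = ≤-reflexive (sym (rowSum-I u))
  ^≤rowSum-pow (suc i) u = begin
    c * c ^ i                                ≤⟨ *-monoˡ-≤ (c ^ i) (c≤rowSum u) ⟩
    rowSum g u * c ^ i                       ≡⟨ *-distribʳ-sum (c ^ i) (g u) ⟩
    sum (λ w → g u w * c ^ i)                ≤⟨ sum-mono-≤ (λ w → *-monoʳ-≤ (g u w) (^≤rowSum-pow i w)) ⟩
    sum (λ w → g u w * rowSum (pow g i) w)   ≡⟨ rowSum-⊙ g (pow g i) u ⟨
    rowSum (pow g (suc i)) u                 ∎
    where open ≤-Reasoning

  M≤rowSum-powSum : ∀ j u → M c j ≤ rowSum (powSum g j) u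
  M≤rowSum-powSum zero    u = ≤-reflexive (sym (rowSum-I u))
  M≤rowSum-powSum (suc j) u = ≤-trans (+-mono-≤ (M≤rowSum-powSum j u) (^≤rowSum-pow (suc j) u))
                                      (≤-reflexive (sym (∑-distrib-+ (powSum g j u) (pow g (suc j) u))))

  rowSum≤-of-powSum≤M : ∀ j u → rowSum (powSum g (suc j)) u ≤ M c (suc j) → rowSum g u ≤ c
  rowSum≤-of-powSum≤M j u bound =
    *-cancelʳ-≤ (rowSum g u) c (M c j) {{>-nonZero (M>0 c j)}} (+-cancelˡ-≤ 1 _ _ (begin
    1 + rowSum g u * M c j                           ≡⟨ cong suc (*-distribʳ-sum (M c j) (g u)) ⟩
    1 + sum (λ w → g u w * M c j)                    ≤⟨ s≤s (sum-mono-≤ (λ w → *-monoʳ-≤ (g u w) (M≤rowSum-powSum j w))) ⟩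
    1 + sum (λ w → g u w * rowSum (powSum g j) w)    ≡⟨ cong₂ _+_ (rowSum-I u) (rowSum-⊙ g (powSum g j) u) ⟨
    rowSum I u + rowSum (g ⊙ powSum g j) u           ≡⟨ ∑-distrib-+ (I u) ((g ⊙ powSum g j) u) ⟨
    rowSum (I ⊕ g ⊙ powSum g j) u                    ≡⟨ sum-cong-≗ (powSum-suc g j u) ⟨
    rowSum (powSum g (suc j)) u                      ≤⟨ bound ⟩
    M c (suc j)                                      ≡⟨ M-suc c j ⟩
    1 + c * M c j                                    ∎))
    where open ≤-Reasoning

module _ {n : ℕ} (g : Matrix n) {F : Pred (Fin n) 0ℓ} (F? : Decidable F)
         (zero-outside : ∀ u w → ¬ F w → g u w ≡ 0) {c : ℕ} (rowSum≡c : ∀ u → F u → rowSum g u ≡ c) where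

  rowSum-pow-on : ∀ i {u} → F u → rowSum (pow g i) u ≡ c ^ i
  rowSum-pow-on zero    {u} _  = rowSum-I u
  rowSum-pow-on (suc i) {u} Fu = begin
    rowSum (pow g (suc i)) u                 ≡⟨ rowSum-⊙ g (pow g i) u ⟩
    sum (λ w → g u w * rowSum (pow g i) w)   ≡⟨ sum-cong-≗ term ⟩
    sum (λ w → g u w * c ^ i)                ≡⟨ *-distribʳ-sum (c ^ i) (g u) ⟨
    rowSum g u * c ^ i                       ≡⟨ cong (_* c ^ i) (rowSum≡c u Fu) ⟩
    c * c ^ i                                ∎
    where
    open ≡-Reasoning
    term : ∀ w → g u w * rowSum (pow g i) w ≡ g u w * c ^ i
    term w with F? w
    ... | yes Fw = cong (g u w *_) (rowSum-pow-on i Fw)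
    ... | no ¬Fw rewrite zero-outside u w ¬Fw = refl

  rowSum-powSum-on : ∀ j {u} → F u → rowSum (powSum g j) u ≡ M c j
  rowSum-powSum-on zero    {u} _  = rowSum-I u
  rowSum-powSum-on (suc j) {u} Fu = trans (∑-distrib-+ (powSum g j u) (pow g (suc j) u))
                                          (cong₂ _+_ (rowSum-powSum-on j Fu) (rowSum-pow-on (suc j) Fu))

-- Walks and geodetic digraphs

adjacency : ∀ {n} → Adj n → Matrix n
adjacency A u w = fromBool (A u w)

listSum-tabulate : ∀ {n} (h : Fin n → ℕ) → Listℕ.sum (List.tabulate h) ≡ sum h
listSum-tabulate {zero}  h = refl
listSum-tabulate {suc n} h = cong (h zero +_) (listSum-tabulate (h ∘ suc))

outdeg≡rowSum : ∀ {n} (A : Adj n) u → outdeg A u ≡ rowSum (adjacency A) u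
outdeg≡rowSum A u = trans (cong Listℕ.sum (List.map-tabulate id (adjacency A u))) (listSum-tabulate (adjacency A u))

walk-zero : ∀ {n} {A : Adj n} {u v} → Walk A u v 0 → u ≡ v
walk-zero (here _) = refl

next-vertex : ∀ {n} {A : Adj n} {u v} → Σ ℕ (Walk A u v) → Fin n
next-vertex {u = u} (_ , here _)           = u
next-vertex         (_ , step {w = w} _ _) = w

module _ {n : ℕ} {A : Adj n} where

  private
    a : Matrix n
    a = adjacency A

  pow-pos⇒Walk : ∀ i {u v} → 0 < pow a i u v → Walk A u v i
  pow-pos⇒Walk zero    {u} p = subst (λ v → Walk A u v 0) (δ-pos p) (here u)
  pow-pos⇒Walk (suc i) {u} p with 0<sum⇒0<term _ p
  ... | w , q with *-pos⁻ (a u w) q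
  ... | u→w , w⇝v = step (fromBool-pos u→w) (pow-pos⇒Walk i w⇝v)

  Walk⇒pow-pos : ∀ {i u v} → Walk A u v i → 0 < pow a i u v
  Walk⇒pow-pos (here v) = ≤-reflexive (sym (δ-refl v))
  Walk⇒pow-pos {suc i} {u} {v} (step {w = w} u→w p) = ≤-trans first-step (term≤sum _ w)
    where
    first-step : 0 < a u w * pow a i w v
    first-step rewrite u→w | +-identityʳ (pow a i w v) = Walk⇒pow-pos p

  powSum-pos⇒Reach : ∀ j {u v} → 0 < powSum a j u v → Reach A j u v
  powSum-pos⇒Reach zero    p = 0 , z≤n , pow-pos⇒Walk 0 p
  powSum-pos⇒Reach (suc j) {u} {v} p with +-pos⁻ (powSum a j u v) p
  ... | inj₁ q = let (i , i≤j , u⇝v) = powSum-pos⇒Reach j q in i , m≤n⇒m≤1+n i≤j , u⇝v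
  ... | inj₂ q = suc j , ≤-refl , pow-pos⇒Walk (suc j) q

  Reach⇒powSum-pos : ∀ {j u v} → Reach A j u v → 0 < powSum a j u v
  Reach⇒powSum-pos {u = u} {v} (i , i≤j , u⇝v) = ≤-trans (Walk⇒pow-pos u⇝v) (pow≤powSum a i≤j u v)

module Geodesics {n : ℕ} {A : Adj n} {k : ℕ} (geodetic : Geodetic k A) where

  private
    a : Matrix n
    a = adjacency A


  walk-length-unique : ∀ {u v i j} → Walk A u v i → Walk A u v j → i ≤ k → j ≤ k → i ≡ j
  walk-length-unique p q i≤k j≤k = cong proj₁ (geodetic _ _ _ _ p q i≤k j≤k)

  no-short-cycle : ∀ {u i} → Walk A u u (suc i) → suc i ≤ k → ⊥
  no-short-cycle p i<k = 0≢1+n (walk-length-unique (here _) p z≤n i<k)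

  next-unique : ∀ {u v w₁ w₂ i j} → A u w₁ ≡ true → Walk A w₁ v i → A u w₂ ≡ true → Walk A w₂ v j →
                suc i ≤ k → suc j ≤ k → w₁ ≡ w₂
  next-unique u→w₁ p u→w₂ q i<k j<k = cong next-vertex (geodetic _ _ _ _ (step u→w₁ p) (step u→w₂ q) i<k j<k)

  pow≤1 : ∀ i u v → i ≤ k → pow a i u v ≤ 1
  pow≤1 zero    u v _   = δ≤1 u v
  pow≤1 (suc i) u v i<k =
    sum≤1 _ (λ w → *-mono-≤ (fromBool≤1 (A u w)) (pow≤1 i w v (≤-trans (n≤1+n i) i<k))) unique
    where
    unique : ∀ w₁ w₂ → 0 < a u w₁ * pow a i w₁ v → 0 < a u w₂ * pow a i w₂ v → w₁ ≡ w₂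
    unique w₁ w₂ p q with *-pos⁻ (a u w₁) p | *-pos⁻ (a u w₂) q
    ... | u→w₁ , w₁⇝v | u→w₂ , w₂⇝v =
      next-unique (fromBool-pos u→w₁) (pow-pos⇒Walk i w₁⇝v) (fromBool-pos u→w₂) (pow-pos⇒Walk i w₂⇝v) i<k i<k

  powSum≤1 : ∀ j u v → j ≤ k → powSum a j u v ≤ 1
  powSum≤1 zero    u v _   = δ≤1 u v
  powSum≤1 (suc j) u v j<k = m+n≤1 (powSum≤1 j u v (≤-trans (n≤1+n j) j<k)) (pow≤1 (suc j) u v j<k) two-lengths
    where
    two-lengths : 0 < powSum a j u v → 0 < pow a (suc j) u v → ⊥
    two-lengths p q with powSum-pos⇒Reach j p
    ... | i , i≤j , short =
      <-irrefl (walk-length-unique short (pow-pos⇒Walk (suc j) q) (≤-trans (m≤n⇒m≤1+n i≤j) j<k) j<k) (s≤s i≤j)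

module OutlierDigraph {n : ℕ} {A : Adj n} {k : ℕ} (geodetic : Geodetic k A)
                      {o : Fin n → Fin n} (outlier : IsOutlier A k o) where

  open Geodesics geodetic public

  private
    a : Matrix n
    a = adjacency A

  outlier-unreachable : ∀ u → ¬ Reach A k u (o u)
  outlier-unreachable u = proj₁ (outlier u)

  outlier-≢ : ∀ u → o u ≢ u
  outlier-≢ u ou≡u = outlier-unreachable u (subst (Reach A k u) (sym ou≡u) (0 , z≤n , here u))

  -- The walk count decides reachability, so uniqueness of the outlier yields an actual walk.
  reachable : ∀ {u v} → v ≢ o u → Reach A k u v
  reachable {u} {v} v≢ou = powSum-pos⇒Reach k (n≢0⇒n>0 λ S≡0 →
    v≢ou (proj₂ (outlier u) v (λ u⇝v → <⇒≢ (Reach⇒powSum-pos u⇝v) (sym S≡0))))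

  outlierMatrix : Matrix n
  outlierMatrix u v = δ (o u) v

  private
    S P : Matrix n
    S = powSum a k
    P = outlierMatrix

  powSum+outlier≡1 : ∀ u v → S u v + P u v ≡ 1
  powSum+outlier≡1 u v with v ≟ᶠ o u
  ... | yes refl = trans (cong (_+ δ (o u) (o u)) unreachable) (δ-refl (o u))
    where
    unreachable : S u (o u) ≡ 0
    unreachable = n≤0⇒n≡0 (≮⇒≥ (outlier-unreachable u ∘ powSum-pos⇒Reach k))
  ... | no v≢ou =
    cong₂ _+_ (≤-antisym (powSum≤1 k u v ≤-refl) (Reach⇒powSum-pos (reachable v≢ou))) (δ-≢ (v≢ou ∘ sym))

  rowSum-powSum : ∀ u → suc (rowSum S u) ≡ n
  rowSum-powSum u = begin
    suc (rowSum S u)               ≡⟨ +-comm 1 (rowSum S u) ⟩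
    rowSum S u + 1                 ≡⟨ cong (rowSum S u +_) (rowSum-I (o u)) ⟨
    rowSum S u + rowSum P u        ≡⟨ ∑-distrib-+ (S u) (P u) ⟨
    sum (λ v → S u v + P u v)      ≡⟨ sum-cong-≗ (powSum+outlier≡1 u) ⟩
    sum {n} (λ _ → 1)              ≡⟨ sum-const n 1 ⟩
    n * 1                          ≡⟨ *-identityʳ n ⟩
    n                              ∎
    where open ≡-Reasoning

  degree-balance : ∀ u v → rowSum a u + a (o u) v ≡ colSum a v + (a ⊙ P) u v
  degree-balance u v = begin
    rowSum a u + a (o u) v              ≡⟨ cong₂ _+_ (sum-cong-≗ (λ w → rows w)) (⊙-identityˡ a (o u) v) ⟨
    (a ⊙ (S ⊕ P)) u v + (P ⊙ a) u v     ≡⟨ outlier-balance a S P (powSum-comm a k) u v ⟩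
    ((S ⊕ P) ⊙ a) u v + (a ⊙ P) u v     ≡⟨ cong (_+ (a ⊙ P) u v) (sum-cong-≗ columns) ⟩
    colSum a v + (a ⊙ P) u v            ∎
    where
    open ≡-Reasoning
    rows : ∀ w → a u w * (S w v + P w v) ≡ a u w
    rows w = trans (cong (a u w *_) (powSum+outlier≡1 w v)) (*-identityʳ (a u w))
    columns : ∀ w → (S u w + P u w) * a w v ≡ a w v
    columns w = trans (cong (_* a w v) (powSum+outlier≡1 u w)) (*-identityˡ (a w v))

iter-comm : ∀ {X : Set} (f : X → X) j x → iter f j (f x) ≡ f (iter f j x)
iter-comm f zero    x = refl
iter-comm f (suc j) x = cong f (iter-comm f j x)

IsOrder-unique : ∀ {n} {f : Fin n → Fin n} {x s t} → IsOrder f x s → IsOrder f x t → s ≡ t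
IsOrder-unique {s = s} {t} (0<s , fˢx≡x , s-least) (0<t , fᵗx≡x , t-least) with <-cmp s t
... | tri< s<t _ _ = ⊥-elim (t-least s 0<s s<t fˢx≡x)
... | tri≈ _ s≡t _ = s≡t
... | tri> _ _ t<s = ⊥-elim (s-least t 0<t t<s fᵗx≡x)

involution⇒IsOrder2 : ∀ {n} {f : Fin n → Fin n} {x} → f x ≢ x → f (f x) ≡ x → IsOrder f x 2
involution⇒IsOrder2 fx≢x ffx≡x =
  s≤s z≤n , ffx≡x , λ { (suc zero) _ _ → fx≢x ; (suc (suc _)) _ (s≤s (s≤s ())) }

-- Induced subdigraphs

count : ∀ {n} → (Fin n → Bool) → ℕ
count P = sum (fromBool ∘ P)

extend : ∀ {m n} b → (Fin m → Fin n) → Fin (fromBool b + m) → Fin (suc n)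
extend true  e zero    = zero
extend true  e (suc i) = suc (e i)
extend false e i       = suc (e i)

embed : ∀ {n} (P : Fin n → Bool) → Fin (count P) → Fin n
embed {suc n} P = extend (P zero) (embed (P ∘ suc))

module _ {m n : ℕ} (e : Fin m → Fin n) where

  extend-P : (Q : Fin (suc n) → Bool) {b : Bool} → Q zero ≡ b → (∀ i → Q (suc (e i)) ≡ true) →
             ∀ i → Q (extend b e i) ≡ true
  extend-P Q {true}  Q₀ _  zero    = Q₀
  extend-P Q {true}  _  Qe (suc i) = Qe i
  extend-P Q {false} _  Qe i       = Qe i

  extend-injective : Injective _≡_ _≡_ e → ∀ b → Injective _≡_ _≡_ (extend b e)
  extend-injective inj true  {zero}  {zero}  _  = refl
  extend-injective inj true  {suc i} {suc j} eq = cong suc (inj (suc-injectiveᶠ eq))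
  extend-injective inj false                 eq = inj (suc-injectiveᶠ eq)

  sum-extend : ∀ b (h : Fin (suc n) → ℕ) → sum (h ∘ extend b e) ≡ fromBool b * h zero + sum (h ∘ suc ∘ e)
  sum-extend true  h = cong (_+ sum (h ∘ suc ∘ e)) (sym (+-identityʳ (h zero)))
  sum-extend false h = refl

embed-P : ∀ {n} (P : Fin n → Bool) i → P (embed P i) ≡ true
embed-P {suc n} P = extend-P (embed (P ∘ suc)) P refl (embed-P (P ∘ suc))

embed-injective : ∀ {n} (P : Fin n → Bool) → Injective _≡_ _≡_ (embed P)
embed-injective {suc n} P = extend-injective (embed (P ∘ suc)) (embed-injective (P ∘ suc)) (P zero)

sum-embed : ∀ {n} (P : Fin n → Bool) (h : Fin n → ℕ) → sum (h ∘ embed P) ≡ sum (λ x → fromBool (P x) * h x)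
sum-embed {zero}  P h = refl
sum-embed {suc n} P h = trans (sum-extend (embed (P ∘ suc)) (P zero) h)
                              (cong (fromBool (P zero) * h zero +_) (sum-embed (P ∘ suc) (h ∘ suc)))

module _ {m n : ℕ} {A : Adj n} {e : Fin m → Fin n} where

  private
    B : Adj m
    B i j = A (e i) (e j)

    embed-walk : ∀ {i j l} → Walk B i j l → Walk A (e i) (e j) l
    embed-walk (here i)   = here (e i)
    embed-walk (step x p) = step x (embed-walk p)


  geodetic-pullback : ∀ {k} → Injective _≡_ _≡_ e → Geodetic k A → Geodetic k B
  geodetic-pullback inj geo i .i 0 0 (here _) (here _) _ _ = refl
  geodetic-pullback inj geo i .i 0 (suc l) (here _) q _ l<k =
    ⊥-elim (0≢1+n (cong proj₁ (geo _ _ 0 (suc l) (here (e i)) (embed-walk q) z≤n l<k)))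
  geodetic-pullback inj geo i .i (suc l) 0 p (here _) l<k _ =
    ⊥-elim (0≢1+n (cong proj₁ (geo _ _ 0 (suc l) (here (e i)) (embed-walk p) z≤n l<k)))
  geodetic-pullback inj geo i j (suc l₁) (suc l₂) (step {w = w₁} i→w₁ p) (step i→w₂ q) l₁<k l₂<k
    with inj (cong next-vertex (geo _ _ _ _ (embed-walk (step i→w₁ p)) (embed-walk (step i→w₂ q)) l₁<k l₂<k))
  ... | refl with geodetic-pullback inj geo w₁ j l₁ l₂ p q (≤-trans (n≤1+n l₁) l₁<k) (≤-trans (n≤1+n l₂) l₂<k)
  ... | refl = cong (λ x → suc l₁ , step x p) (Decidable⇒UIP.≡-irrelevant Bool._≟_ i→w₁ i→w₂)

induced-plusOne : ∀ {n d k} (A : Adj n) → Loopless A → Geodetic k A →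
                  (P : Fin n → Bool) → count P ≡ suc (M d k) →
                  (∀ u → P u ≡ true → d ≤ sum (λ w → fromBool (P w) * adjacency A u w)) →
                  Σ (Adj (suc (M d k))) (IsPlusOne d k)
induced-plusOne {d = d} {k} A loopless geodetic P size≡ degree =
  plusOne size≡ B (loopless ∘ embed P) (geodetic-pullback (embed-injective P) geodetic) outdegree
  where
  B : Adj (count P)
  B i j = A (embed P i) (embed P j)
  outdegree : ∀ i → d ≤ outdeg B i
  outdegree i = subst (d ≤_) (sym (trans (outdeg≡rowSum B i) (sum-embed P (adjacency A (embed P i)))))
                      (degree (embed P i) (embed-P P i))
  plusOne : ∀ {m} → m ≡ suc (M d k) → (C : Adj m) → Loopless C → Geodetic k C → (∀ v → d ≤ outdeg C v) →
            Σ (Adj (suc (M d k))) (IsPlusOne d k)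
  plusOne refl C l g mindeg = C , record { loopless = l ; geodetic = g ; minOutdeg = mindeg }

-- (d,k;+1)-digraphs

module PlusOneDigraph {d k : ℕ} (2≤k : 2 ≤ k) {A : Adj (suc (M d k))} (G : IsPlusOne d k A)
                      {o : Fin (suc (M d k)) → Fin (suc (M d k))} (outlier : IsOutlier A k o) where

  open IsPlusOne G
  open OutlierDigraph geodetic outlier

  private
    Vertex : Set
    Vertex = Fin (suc (M d k))
    P : Matrix (suc (M d k))
    P = outlierMatrix

  a : Matrix (suc (M d k))
  a = adjacency A

  outdegree≡d : ∀ u → rowSum a u ≡ d
  outdegree≡d u = ≤-antisym (rowSum≤-of-powSum≤M a d≤outdegree (pred k) u bound) (d≤outdegree u)
    where
    d≤outdegree : ∀ w → d ≤ rowSum a w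
    d≤outdegree w = subst (d ≤_) (outdeg≡rowSum A w) (minOutdeg w)
    bound : rowSum (powSum a (suc (pred k))) u ≤ M d (suc (pred k))
    bound = subst (λ m → rowSum (powSum a m) u ≤ M d m) (sym (suc-pred k {{>-nonZero (≤-trans (s≤s z≤n) 2≤k)}}))
                  (≤-reflexive (suc-injective (rowSum-powSum u)))

  indegree-balance : ∀ u v → colSum a v + (a ⊙ P) u v ≡ d + a (o u) v
  indegree-balance u v = sym (trans (cong (_+ a (o u) v) (sym (outdegree≡d u))) (degree-balance u v))

  module NonRegular (v₀ : Vertex) (d<indegree : d < colSum a v₀) where

    outlier→v₀ : ∀ u → A (o u) v₀ ≡ true
    outlier→v₀ u with A (o u) v₀ in ou↛v₀
    ... | true  = refl
    ... | false = ⊥-elim (<⇒≱ d<indegree (≤-trans (m≤m+n _ _) (≤-reflexive (begin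
      colSum a v₀ + (a ⊙ P) u v₀      ≡⟨ indegree-balance u v₀ ⟩
      d + fromBool (A (o u) v₀)       ≡⟨ cong (λ b → d + fromBool b) ou↛v₀ ⟩
      d + 0                           ≡⟨ +-identityʳ d ⟩
      d                               ∎))))
      where open ≡-Reasoning

    outliers-nonadjacent : ∀ u₁ u₂ → A (o u₁) (o u₂) ≡ true → ⊥
    outliers-nonadjacent u₁ u₂ ou₁→ou₂ = 1+n≢n (walk-length-unique
      (step ou₁→ou₂ (step (outlier→v₀ u₂) (here v₀))) (step (outlier→v₀ u₁) (here v₀)) 2≤k (≤-trans (n≤1+n 1) 2≤k))

    outliers-share-outneighbours : ∀ u₁ u₂ {w} → A (o u₁) w ≡ true → A (o u₂) w ≡ true
    outliers-share-outneighbours u₁ u₂ {w} ou₁→w =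
      fromBool-pos (subst (0 <_) (+-cancelˡ-≡ d _ _ same-balance) (≤-reflexive (sym (cong fromBool ou₁→w))))
      where
      no-preimage : ∀ u → (a ⊙ P) u w ≡ 0
      no-preimage u = sum-zero {f = λ x → a u x * δ (o x) w} λ x → trans (cong (a u x *_) (δ-≢ λ ox≡w →
        outliers-nonadjacent u₁ x (subst (λ v → A (o u₁) v ≡ true) (sym ox≡w) ou₁→w))) (*-zeroʳ (a u x))
      same-balance : d + a (o u₁) w ≡ d + a (o u₂) w
      same-balance = trans (sym (indegree-balance u₁ w))
                           (trans (cong (colSum a w +_) (trans (no-preimage u₁) (sym (no-preimage u₂))))
                                  (indegree-balance u₂ w))

    outlier-involutive : ∀ y → o (o (o y)) ≡ o y
    outlier-involutive y with o (o (o y)) ≟ᶠ o y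
    ... | yes oooy≡oy = oooy≡oy
    ... | no  oooy≢oy with reachable {u = o y} (outlier-≢ (o (o y)))
    ... | zero  , _   , p                = ⊥-elim (oooy≢oy (sym (walk-zero p)))
    ... | suc l , l<k , step oy→w w⇝oooy =
      ⊥-elim (outlier-unreachable (o (o y)) (suc l , l<k , step (outliers-share-outneighbours y (o y) oy→w) w⇝oooy))

    order≡2 : ∀ {x t} → IsOrder o x t → t ≡ 2
    order≡2 {x} {suc t} ord@(_ , oᵗ⁺¹x≡x , _) = IsOrder-unique ord (involution⇒IsOrder2 (outlier-≢ x) oox≡x)
      where
      oox≡x : o (o x) ≡ x
      oox≡x = subst (λ z → o (o z) ≡ z) oᵗ⁺¹x≡x (outlier-involutive (iter o t x))

  module Regular (indegree≡d : ∀ v → colSum a v ≡ d) where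

    a⊙P≡P⊙a : ∀ u v → (a ⊙ P) u v ≡ a (o u) v
    a⊙P≡P⊙a u v = +-cancelˡ-≡ d _ _ (trans (cong (_+ (a ⊙ P) u v) (sym (indegree≡d v))) (indegree-balance u v))

    private
      preimage-term : ∀ {u w} → A u w ≡ true → a u w * δ (o w) (o w) ≡ 1
      preimage-term {w = w} u→w = cong₂ _*_ (cong fromBool u→w) (δ-refl (o w))

    outlier-preserves-arcs : ∀ {u w} → A u w ≡ true → A (o u) (o w) ≡ true
    outlier-preserves-arcs {u} {w} u→w = fromBool-pos (subst (0 <_) (a⊙P≡P⊙a u (o w))
      (≤-trans (≤-reflexive (sym (preimage-term u→w))) (term≤sum (λ x → a u x * δ (o x) (o w)) w)))

    outlier-injective-on-outneighbours : ∀ {u w₁ w₂} → A u w₁ ≡ true → A u w₂ ≡ true →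
                                         o w₁ ≡ o w₂ → w₁ ≡ w₂
    outlier-injective-on-outneighbours {u} {w₁} {w₂} u→w₁ u→w₂ ow₁≡ow₂ with w₁ ≟ᶠ w₂
    ... | yes w₁≡w₂ = w₁≡w₂
    ... | no  w₁≢w₂ = ⊥-elim (<⇒≱ two-preimages (subst (_≤ 1) (sym (a⊙P≡P⊙a u (o w₁))) (fromBool≤1 _)))
      where
      second-term : a u w₂ * δ (o w₂) (o w₁) ≡ 1
      second-term = subst (λ z → a u w₂ * δ (o w₂) z ≡ 1) (sym ow₁≡ow₂) (preimage-term u→w₂)
      two-preimages : 1 < (a ⊙ P) u (o w₁)
      two-preimages = ≤-trans (≤-reflexive (sym (cong₂ _+_ (preimage-term u→w₁) second-term)))
                              (two-terms≤sum (λ x → a u x * δ (o x) (o w₁)) w₁≢w₂)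

    iter-preserves-arcs : ∀ j {u w} → A u w ≡ true → A (iter o j u) (iter o j w) ≡ true
    iter-preserves-arcs zero    u→w = u→w
    iter-preserves-arcs (suc j) u→w = outlier-preserves-arcs (iter-preserves-arcs j u→w)

    module FixedPoints {x₀ : Vertex} {t : ℕ} (ord : IsOrder o x₀ t) where

      φ : Vertex → Vertex
      φ = iter o t

      Fixed : Pred Vertex 0ℓ
      Fixed y = φ y ≡ y

      fixed? : Decidable Fixed
      fixed? y = φ y ≟ᶠ y

      -- Opaque, so that case splits on fixed? do not rewrite inside χ.
      opaque
        χ : Vertex → ℕ
        χ y = fromBool (does (fixed? y))

        χ-does : ∀ y → fromBool (does (fixed? y)) ≡ χ y
        χ-does y = refl

        χ-fixed : ∀ {y} → Fixed y → χ y ≡ 1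
        χ-fixed {y} φy≡y with fixed? y
        ... | yes _     = refl
        ... | no ¬φy≡y = ⊥-elim (¬φy≡y φy≡y)

        χ-unfixed : ∀ {y} → ¬ Fixed y → χ y ≡ 0
        χ-unfixed {y} ¬φy≡y with fixed? y
        ... | yes φy≡y = ⊥-elim (¬φy≡y φy≡y)
        ... | no _     = refl

        χ≤1 : ∀ y → χ y ≤ 1
        χ≤1 y = fromBool≤1 (does (fixed? y))

        χ≡1⇒fixed : ∀ {y} → χ y ≡ 1 → Fixed y
        χ≡1⇒fixed {y} _ with fixed? y
        ... | yes φy≡y = φy≡y

      x₀-fixed : Fixed x₀
      x₀-fixed = proj₁ (proj₂ ord)

      fixed-outlier : ∀ {y} → Fixed y → Fixed (o y)
      fixed-outlier {y} φy≡y = trans (iter-comm o t y) (cong o φy≡y)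

      fixed-iter : ∀ i {y} → Fixed y → Fixed (iter o i y)
      fixed-iter zero    φy≡y = φy≡y
      fixed-iter (suc i) φy≡y = fixed-outlier (fixed-iter i φy≡y)

      φ-walk : ∀ {u v l} → Walk A u v l → Walk A (φ u) (φ v) l
      φ-walk (here v)     = here (φ v)
      φ-walk (step u→w p) = step (iter-preserves-arcs t u→w) (φ-walk p)

      -- φ fixes u and v and preserves arcs, so it maps the unique short walk from u to v to itself.
      fixed-closed : ∀ {u v w l} → Fixed u → Fixed v → A u w ≡ true → Walk A w v l → suc l ≤ k → Fixed w
      fixed-closed {u} {v} {w} {l} φu≡u φv≡v u→w w⇝v l<k = sym (next-unique u→w w⇝v u→φw φw⇝v l<k l<k)
        where
        u→φw : A u (φ w) ≡ true
        u→φw = subst (λ z → A z (φ w) ≡ true) φu≡u (iter-preserves-arcs t u→w)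
        φw⇝v : Walk A (φ w) v l
        φw⇝v = subst (λ z → Walk A (φ w) z l) φv≡v (φ-walk w⇝v)

      fixed-preimage : ∀ {u v w} → Fixed u → Fixed v → A u w ≡ true → o w ≡ v → Fixed w
      fixed-preimage {u} {v} {w} φu≡u φv≡v u→w ow≡v = outlier-injective-on-outneighbours u→φw u→w oφw≡ow
        where
        u→φw : A u (φ w) ≡ true
        u→φw = subst (λ z → A z (φ w) ≡ true) φu≡u (iter-preserves-arcs t u→w)
        oφw≡ow : o (φ w) ≡ o w
        oφw≡ow = trans (sym (iter-comm o t w)) (trans (cong φ ow≡v) (trans φv≡v (sym ow≡v)))

      -- The subdigraph induced on the fixed points, kept on the whole vertex set with zero rows and
      -- columns at the other vertices.
      H : Matrix (suc (M d k))
      H u w = χ u * a u w * χ w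

      H-fixedˡ : ∀ {u} w → Fixed u → H u w ≡ χ w * a u w
      H-fixedˡ {u} w φu≡u rewrite χ-fixed φu≡u =
        trans (cong (_* χ w) (*-identityˡ (a u w))) (*-comm (a u w) (χ w))

      H-fixed : ∀ {u w} → Fixed u → Fixed w → H u w ≡ a u w
      H-fixed {u} {w} φu≡u φw≡w =
        trans (H-fixedˡ w φu≡u) (trans (cong (_* a u w) (χ-fixed φw≡w)) (*-identityˡ (a u w)))

      H-unfixedˡ : ∀ {u} w → ¬ Fixed u → H u w ≡ 0
      H-unfixedˡ w ¬φu≡u rewrite χ-unfixed ¬φu≡u = refl

      H-unfixedʳ : ∀ u {w} → ¬ Fixed w → H u w ≡ 0
      H-unfixedʳ u {w} ¬φw≡w rewrite χ-unfixed ¬φw≡w = *-zeroʳ (χ u * a u w)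

      H≤a : ∀ u w → H u w ≤ a u w
      H≤a u w = ≤-trans (*-mono-≤ (*-monoˡ-≤ (a u w) (χ≤1 u)) (χ≤1 w))
                        (≤-reflexive (trans (*-identityʳ (1 * a u w)) (*-identityˡ (a u w))))

      private
        S : Matrix (suc (M d k))
        S = powSum H k

      pow-H : ∀ i {u} v → Fixed u → i ≤ k → pow H i u v ≡ χ v * pow a i u v
      pow-H zero {u} v φu≡u _ = diagonal (u ≟ᶠ v)
        where
        diagonal : Dec (u ≡ v) → δ u v ≡ χ v * δ u v
        diagonal (yes refl) = trans (δ-refl u) (sym (cong₂ _*_ (χ-fixed φu≡u) (δ-refl u)))
        diagonal (no u≢v)   = trans (δ-≢ u≢v) (sym (trans (cong (χ v *_) (δ-≢ u≢v)) (*-zeroʳ (χ v))))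
      pow-H (suc i) {u} v φu≡u i<k =
        trans (sum-cong-≗ term) (sym (*-distribˡ-sum (χ v) (λ w → a u w * pow a i w v)))
        where
        leaves-fixed : ∀ {w} → Fixed v → ¬ Fixed w → a u w * pow a i w v ≡ 0
        leaves-fixed φv≡v ¬φw≡w = n≤0⇒n≡0 (≮⇒≥ λ pos → let (u→w , w⇝v) = *-pos⁻ _ pos in
          ¬φw≡w (fixed-closed φu≡u φv≡v (fromBool-pos u→w) (pow-pos⇒Walk i w⇝v) i<k))
        term : ∀ w → H u w * pow H i w v ≡ χ v * (a u w * pow a i w v)
        term w with fixed? w | fixed? v
        ... | yes φw≡w | _ = trans (cong₂ _*_ (H-fixed φu≡u φw≡w) (pow-H i v φw≡w (≤-trans (n≤1+n i) i<k)))
                                   (*-CS.x∙yz≈y∙xz (a u w) (χ v) _)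
        ... | no ¬φw≡w | yes φv≡v = trans (cong (_* pow H i w v) (H-unfixedʳ u ¬φw≡w))
                                         (sym (trans (cong (χ v *_) (leaves-fixed φv≡v ¬φw≡w)) (*-zeroʳ (χ v))))
        ... | no ¬φw≡w | no ¬φv≡v = trans (cong (_* pow H i w v) (H-unfixedʳ u ¬φw≡w))
                                         (sym (cong (_* (a u w * pow a i w v)) (χ-unfixed ¬φv≡v)))

      powSum-H : ∀ j {u} v → Fixed u → j ≤ k → powSum H j u v ≡ χ v * powSum a j u v
      powSum-H zero    v φu≡u j≤k = pow-H zero v φu≡u j≤k
      powSum-H (suc j) v φu≡u j<k =
        trans (cong₂ _+_ (powSum-H j v φu≡u (≤-trans (n≤1+n j) j<k)) (pow-H (suc j) v φu≡u j<k))
              (sym (*-distribˡ-+ (χ v) _ _))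

      powSum-H+outlier≡1 : ∀ {u v} → Fixed u → Fixed v → S u v + P u v ≡ 1
      powSum-H+outlier≡1 {u} {v} φu≡u φv≡v = trans (cong (_+ P u v) S≡powSum) (powSum+outlier≡1 u v)
        where
        S≡powSum : S u v ≡ powSum a k u v
        S≡powSum = trans (powSum-H k v φu≡u ≤-refl)
                         (trans (cong (_* powSum a k u v) (χ-fixed φv≡v)) (*-identityˡ _))

      H⊙P≡P⊙a : ∀ {u v} → Fixed u → Fixed v → (H ⊙ P) u v ≡ a (o u) v
      H⊙P≡P⊙a {u} {v} φu≡u φv≡v = trans (sum-cong-≗ term) (a⊙P≡P⊙a u v)
        where
        term : ∀ w → H u w * P w v ≡ a u w * P w v
        term w with fixed? w
        ... | yes φw≡w = cong (_* P w v) (H-fixed φu≡u φw≡w)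
        ... | no ¬φw≡w = trans (cong (_* P w v) (H-unfixedʳ u ¬φw≡w)) (sym (n≤0⇒n≡0 (≮⇒≥ λ pos →
          let (u→w , ow≡v) = *-pos⁻ (a u w) pos in
          ¬φw≡w (fixed-preimage φu≡u φv≡v (fromBool-pos u→w) (δ-pos ow≡v)))))

      P⊙H≡P⊙a : ∀ {u v} → Fixed u → Fixed v → (P ⊙ H) u v ≡ a (o u) v
      P⊙H≡P⊙a {u} {v} φu≡u φv≡v = trans (⊙-identityˡ H (o u) v) (H-fixed (fixed-outlier φu≡u) φv≡v)

      H⊙[S⊕P]≡rowSum : ∀ u {v} → Fixed v → (H ⊙ (S ⊕ P)) u v ≡ rowSum H u
      H⊙[S⊕P]≡rowSum u {v} φv≡v = sum-cong-≗ term
        where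
        term : ∀ w → H u w * (S w v + P w v) ≡ H u w
        term w with fixed? w
        ... | yes φw≡w = trans (cong (H u w *_) (powSum-H+outlier≡1 φw≡w φv≡v)) (*-identityʳ (H u w))
        ... | no ¬φw≡w rewrite H-unfixedʳ u ¬φw≡w = refl

      [S⊕P]⊙H≡colSum : ∀ {u} v → Fixed u → ((S ⊕ P) ⊙ H) u v ≡ colSum H v
      [S⊕P]⊙H≡colSum {u} v φu≡u = sum-cong-≗ term
        where
        term : ∀ w → (S u w + P u w) * H w v ≡ H w v
        term w with fixed? w
        ... | yes φw≡w = trans (cong (_* H w v) (powSum-H+outlier≡1 φu≡u φw≡w)) (*-identityˡ (H w v))
        ... | no ¬φw≡w rewrite H-unfixedˡ v ¬φw≡w = *-zeroʳ (S u w + P u w)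

      rowSum≡colSum : ∀ {u v} → Fixed u → Fixed v → rowSum H u ≡ colSum H v
      rowSum≡colSum {u} {v} φu≡u φv≡v = +-cancelʳ-≡ (a (o u) v) _ _ (begin
        rowSum H u + a (o u) v              ≡⟨ cong₂ _+_ (H⊙[S⊕P]≡rowSum u φv≡v) (P⊙H≡P⊙a φu≡u φv≡v) ⟨
        (H ⊙ (S ⊕ P)) u v + (P ⊙ H) u v     ≡⟨ outlier-balance H S P (powSum-comm H k) u v ⟩
        ((S ⊕ P) ⊙ H) u v + (H ⊙ P) u v     ≡⟨ cong₂ _+_ ([S⊕P]⊙H≡colSum v φu≡u) (H⊙P≡P⊙a φu≡u φv≡v) ⟩
        colSum H v + a (o u) v              ∎)
        where open ≡-Reasoning

      d′ : ℕ
      d′ = rowSum H x₀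

      rowSum-H : ∀ {u} → Fixed u → rowSum H u ≡ d′
      rowSum-H φu≡u = trans (rowSum≡colSum φu≡u x₀-fixed) (sym (rowSum≡colSum x₀-fixed x₀-fixed))

      rowSum-pow-H : ∀ i {u} → Fixed u → rowSum (pow H i) u ≡ d′ ^ i
      rowSum-pow-H = rowSum-pow-on H fixed? (λ u _ → H-unfixedʳ u) (λ _ → rowSum-H)

      rowSum-powSum-H : ∀ j {u} → Fixed u → rowSum (powSum H j) u ≡ M d′ j
      rowSum-powSum-H = rowSum-powSum-on H fixed? (λ u _ → H-unfixedʳ u) (λ _ → rowSum-H)

      d′≤d : d′ ≤ d
      d′≤d = ≤-trans (sum-mono-≤ (H≤a x₀)) (≤-reflexive (outdegree≡d x₀))

      count-fixed : sum χ ≡ suc (M d′ k)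
      count-fixed = begin
        sum χ                                         ≡⟨ sum-cong-≗ split ⟩
        sum (λ v → S x₀ v + P x₀ v * χ v)             ≡⟨ ∑-distrib-+ (S x₀) (λ v → P x₀ v * χ v) ⟩
        rowSum S x₀ + sum (λ v → δ (o x₀) v * χ v)    ≡⟨ cong₂ _+_ (rowSum-powSum-H k x₀-fixed) (sum-δˡ (o x₀) χ) ⟩
        M d′ k + χ (o x₀)                             ≡⟨ cong (M d′ k +_) (χ-fixed (fixed-outlier x₀-fixed)) ⟩
        M d′ k + 1                                    ≡⟨ +-comm (M d′ k) 1 ⟩
        suc (M d′ k)                                  ∎
        where
        open ≡-Reasoning
        split : ∀ v → χ v ≡ S x₀ v + P x₀ v * χ v
        split v with fixed? v
        ... | yes φv≡v rewrite χ-fixed φv≡v | *-identityʳ (P x₀ v) = sym (powSum-H+outlier≡1 x₀-fixed φv≡v)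
        ... | no ¬φv≡v rewrite powSum-H k v x₀-fixed ≤-refl | χ-unfixed ¬φv≡v = sym (*-zeroʳ (P x₀ v))

      fixed-outneighbour⇒0<d′ : ∀ {w} → A x₀ w ≡ true → Fixed w → 0 < d′
      fixed-outneighbour⇒0<d′ {w} x₀→w φw≡w =
        ≤-trans (≤-reflexive (sym (trans (H-fixed x₀-fixed φw≡w) (cong fromBool x₀→w)))) (term≤sum (H x₀) w)

      d′≡0⇒t≡2 : d′ ≡ 0 → t ≡ 2
      d′≡0⇒t≡2 d′≡0 = IsOrder-unique ord (involution⇒IsOrder2 (outlier-≢ x₀) oox₀≡x₀)
        where
        oox₀≡x₀ : o (o x₀) ≡ x₀
        oox₀≡x₀ with o (o x₀) ≟ᶠ x₀
        ... | yes oox₀≡x₀ = oox₀≡x₀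
        ... | no  oox₀≢x₀ with reachable {u = x₀} (outlier-≢ (o x₀))
        ... | zero  , _   , p              = ⊥-elim (oox₀≢x₀ (sym (walk-zero p)))
        ... | suc l , l<k , step x₀→w w⇝oox₀ =
          ⊥-elim (<⇒≢ (fixed-outneighbour⇒0<d′ x₀→w φw≡w) (sym d′≡0))
          where
          φw≡w : Fixed _
          φw≡w = fixed-closed x₀-fixed (fixed-outlier (fixed-outlier x₀-fixed)) x₀→w w⇝oox₀ l<k

      module OutdegreeOne (d′≡1 : d′ ≡ 1) where

        pow-H+P⊙a : ∀ {u v} → Fixed u → Fixed v → pow H (suc k) u v + a (o u) v ≡ I u v + P u v
        pow-H+P⊙a {u} {v} φu≡u φv≡v =
          cancel-complements {x = (H ⊙ S) u v} {s = S u v} horner rows (powSum-H+outlier≡1 φu≡u φv≡v)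
          where
          horner : (H ⊙ S) u v + I u v ≡ S u v + pow H (suc k) u v
          horner = trans (+-comm _ (I u v)) (sym (powSum-suc H k u v))
          rows : (H ⊙ S) u v + a (o u) v ≡ 1
          rows = begin
            (H ⊙ S) u v + a (o u) v        ≡⟨ cong ((H ⊙ S) u v +_) (H⊙P≡P⊙a φu≡u φv≡v) ⟨
            (H ⊙ S) u v + (H ⊙ P) u v      ≡⟨ ⊙-distribˡ-⊕ H S P u v ⟨
            (H ⊙ (S ⊕ P)) u v              ≡⟨ H⊙[S⊕P]≡rowSum u φv≡v ⟩
            rowSum H u                     ≡⟨ trans (rowSum-H φu≡u) d′≡1 ⟩
            1                              ∎
            where open ≡-Reasoning

        arc-from-outlier : ∀ {u} → Fixed u → A (o u) u ≡ true
        arc-from-outlier {u} φu≡u = fromBool-pos (≤-reflexive (sym (begin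
          a (o u) u          ≡⟨ H-fixed φou≡ou φu≡u ⟨
          H (o u) u          ≡⟨ sum-only (H (o u)) u elsewhere ⟨
          rowSum H (o u)     ≡⟨ trans (rowSum-H φou≡ou) d′≡1 ⟩
          1                  ∎)))
          where
          open ≡-Reasoning
          φou≡ou : Fixed (o u)
          φou≡ou = fixed-outlier φu≡u
          elsewhere : ∀ v → v ≢ u → H (o u) v ≡ 0
          elsewhere v v≢u with fixed? v
          ... | no ¬φv≡v = H-unfixedʳ (o u) ¬φv≡v
          ... | yes φv≡v with v ≟ᶠ o u
          ...   | yes refl = trans (H-fixed φou≡ou φou≡ou) (cong fromBool (loopless (o u)))
          ...   | no v≢ou  = trans (H-fixed φou≡ou φv≡v) (m+n≡0⇒n≡0 (pow H (suc k) u v)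
                               (trans (pow-H+P⊙a φu≡u φv≡v) (cong₂ _+_ (δ-≢ (v≢u ∘ sym)) (δ-≢ (v≢ou ∘ sym)))))

        pow-H-outlier : ∀ {u} → Fixed u → pow H (suc k) u (o u) ≡ 1
        pow-H-outlier {u} φu≡u = begin
          pow H (suc k) u (o u)                      ≡⟨ +-identityʳ _ ⟨
          pow H (suc k) u (o u) + 0                  ≡⟨ cong (pow H (suc k) u (o u) +_) (cong fromBool (loopless (o u))) ⟨
          pow H (suc k) u (o u) + a (o u) (o u)      ≡⟨ pow-H+P⊙a φu≡u (fixed-outlier φu≡u) ⟩
          δ u (o u) + δ (o u) (o u)                  ≡⟨ cong₂ _+_ (δ-≢ (outlier-≢ u ∘ sym)) (δ-refl (o u)) ⟩
          1                                          ∎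
          where open ≡-Reasoning

        walk-back : ∀ {y} → Fixed y → ∀ i → 0 < pow H i (iter o i y) y
        walk-back {y} φy≡y zero    = ≤-reflexive (sym (δ-refl y))
        walk-back {y} φy≡y (suc i) = ≤-trans back-step (term≤sum (λ z → H (o w) z * pow H i z y) w)
          where
          w : Vertex
          w = iter o i y
          φw≡w : Fixed w
          φw≡w = fixed-iter i φy≡y
          back-step : 0 < H (o w) w * pow H i w y
          back-step rewrite H-fixed (fixed-outlier φw≡w) φw≡w | arc-from-outlier φw≡w | +-identityʳ (pow H i w y) =
            walk-back φy≡y i

        H-walk : ∀ {i u v} → 0 < pow H i u v → Walk A u v i
        H-walk {i} {u} {v} pos = pow-pos⇒Walk i (≤-trans pos (pow-mono-≤ H≤a i u v))

        no-return-before-k+1 : ∀ i → 0 < i → i ≤ k → iter o i x₀ ≢ x₀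
        no-return-before-k+1 (suc i) _ i<k oⁱx₀≡x₀ =
          no-short-cycle (H-walk (subst (λ z → 0 < pow H (suc i) z x₀) oⁱx₀≡x₀ (walk-back x₀-fixed (suc i)))) i<k

        no-return-at-k+1 : iter o (suc k) x₀ ≢ x₀
        no-return-at-k+1 oᵏ⁺¹x₀≡x₀ = outlier-unreachable x₀ (k , ≤-refl , H-walk (subst (λ z → 0 < pow H k z (o x₀))
          (trans (iter-comm o k x₀) oᵏ⁺¹x₀≡x₀) (walk-back (fixed-outlier x₀-fixed) k)))

        return-at-k+2 : iter o (suc (suc k)) x₀ ≡ x₀
        return-at-k+2 with x₀ ≟ᶠ o (iter o (suc k) x₀)
        ... | yes x₀≡oy = sym x₀≡oy
        ... | no  x₀≢oy = ⊥-elim (1+n≰n (begin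
          1 + 1                                        ≤⟨ +-mono-≤ (walk-back x₀-fixed (suc k)) (≤-reflexive (sym oy-term)) ⟩
          pow H (suc k) y x₀ + pow H (suc k) y (o y)   ≤⟨ two-terms≤sum (pow H (suc k) y) x₀≢oy ⟩
          rowSum (pow H (suc k)) y                     ≡⟨ rowSum-pow-H (suc k) φy≡y ⟩
          d′ ^ suc k                                   ≡⟨ trans (cong (_^ suc k) d′≡1) (^-zeroˡ (suc k)) ⟩
          1                                            ∎))
          where
          open ≤-Reasoning
          y : Vertex
          y = iter o (suc k) x₀
          φy≡y : Fixed y
          φy≡y = fixed-iter (suc k) x₀-fixed
          oy-term : pow H (suc k) y (o y) ≡ 1
          oy-term = pow-H-outlier φy≡y

        t≡k+2 : t ≡ k + 2
        t≡k+2 = trans (IsOrder-unique ord (s≤s z≤n , return-at-k+2 , no-earlier-return)) (+-comm 2 k)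
          where
          no-earlier-return : ∀ i → 0 < i → i < suc (suc k) → iter o i x₀ ≢ x₀
          no-earlier-return i 0<i i<k+2 with m≤n⇒m<n∨m≡n (≤-pred i<k+2)
          ... | inj₁ i≤k  = no-return-before-k+1 i 0<i (≤-pred i≤k)
          ... | inj₂ refl = no-return-at-k+1

      fixed-subdigraph : Σ (Adj (suc (M d′ k))) (IsPlusOne d′ k)
      fixed-subdigraph =
        induced-plusOne A loopless geodetic (does ∘ fixed?) (trans (sum-cong-≗ χ-does) count-fixed) outdegree
        where
        outdegree : ∀ u → does (fixed? u) ≡ true → d′ ≤ sum (λ w → fromBool (does (fixed? w)) * a u w)
        outdegree u u-fixed = ≤-reflexive (begin
          d′                                                ≡⟨ rowSum-H φu≡u ⟨
          rowSum H u                                        ≡⟨ sum-cong-≗ (λ w → trans (H-fixedˡ w φu≡u) (cong (_* a u w) (sym (χ-does w)))) ⟩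
          sum (λ w → fromBool (does (fixed? w)) * a u w)    ∎)
          where
          open ≡-Reasoning
          φu≡u : Fixed u
          φu≡u = χ≡1⇒fixed (trans (sym (χ-does u)) (cong fromBool u-fixed))

      d′≡d⇒all-fixed : d′ ≡ d → ∀ v → Fixed v
      d′≡d⇒all-fixed d′≡d v = χ≡1⇒fixed (pointwise≤∧sum≥⇒pointwise≡ χ≤1 everything v)
        where
        everything : sum {suc (M d k)} (λ _ → 1) ≤ sum χ
        everything = ≤-reflexive (trans (sum-const (suc (M d k)) 1)
                                        (trans (*-identityʳ _) (sym (trans count-fixed (cong (λ c → suc (M c k)) d′≡d)))))

      order-cases : Minimal d k → t ≡ 2 ⊎ t ≡ k + 2 ⊎ (∀ v → iter o t v ≡ v)
      order-cases minimal with d′ in d′≡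
      ... | zero        = inj₁ (d′≡0⇒t≡2 d′≡)
      ... | suc zero    = inj₂ (inj₁ (OutdegreeOne.t≡k+2 d′≡))
      ... | suc (suc m) with m≤n⇒m<n∨m≡n d′≤d
      ...   | inj₁ d′<d = ⊥-elim (minimal (suc (suc m)) (s≤s (s≤s z≤n)) (subst (_< d) d′≡ d′<d)
                            (subst (λ c → Σ (Adj (suc (M c k))) (IsPlusOne c k)) d′≡ fixed-subdigraph))
      ...   | inj₂ d′≡d = inj₂ (inj₂ (d′≡d⇒all-fixed d′≡d))

  order-classification : Minimal d k → ∀ {x t} → IsOrder o x t →
                         t ≡ 2 ⊎ t ≡ k + 2 ⊎ (∀ v → iter o t v ≡ v)
  order-classification minimal ord with all? (λ v → colSum a v ≤? d)
  ... | no ¬regular = let (v₀ , indegree≰d) = ¬∀⟶∃¬ _ _ (λ v → colSum a v ≤? d) ¬regular in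
                      inj₁ (NonRegular.order≡2 v₀ (≰⇒> indegree≰d) ord)
  ... | yes indegree≤d = Regular.FixedPoints.order-cases indegree≡d ord minimal
    where
    indegree≡d : ∀ v → colSum a v ≡ d
    indegree≡d = pointwise≤∧sum≥⇒pointwise≡ indegree≤d (≤-reflexive (begin
      sum {suc (M d k)} (λ _ → d)     ≡⟨ sum-cong-≗ outdegree≡d ⟨
      sum (rowSum a)                  ≡⟨ ∑-comm a ⟩
      sum (colSum a)                  ∎))
      where open ≡-Reasoning

  non-maximal-order : Minimal d k → ∀ {x y t s} → IsOrder o x t → IsOrder o y s → t < s → t ≡ 2 ⊎ t ≡ k + 2
  non-maximal-order minimal {y = y} ordˣ ordʸ t<s with order-classification minimal ordˣ
  ... | inj₁ t≡2          = inj₁ t≡2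
  ... | inj₂ (inj₁ t≡k+2) = inj₂ t≡k+2
  ... | inj₂ (inj₂ oᵗ≡id) = ⊥-elim (proj₂ (proj₂ ordʸ) _ (proj₁ ordˣ) t<s (oᵗ≡id y))

mainTheorem10 : ∀ (d k : ℕ) → 2 ≤ d → 2 ≤ k →
    (A : Adj (suc (M d k))) → IsPlusOne d k A → Minimal d k →
    (o : Fin (suc (M d k)) → Fin (suc (M d k))) → IsOutlier A k o →
    (∀ (v₁ v₂ v₃ v₄ : Fin (suc (M d k))) (t₁ t₂ t₃ t₄ : ℕ) →
      IsOrder o v₁ t₁ → IsOrder o v₂ t₂ → IsOrder o v₃ t₃ → IsOrder o v₄ t₄ →
      t₁ < t₂ → t₂ < t₃ → t₃ < t₄ → ⊥)
    × (∀ (v₁ v₂ v₃ : Fin (suc (M d k))) (s₁ s₂ s₃ : ℕ) →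
      IsOrder o v₁ s₁ → IsOrder o v₂ s₂ → IsOrder o v₃ s₃ →
      s₁ < s₂ → s₂ < s₃ → s₁ ≡ 2 × s₂ ≡ k + 2)
mainTheorem10 d k _ 2≤k A G minimal o outlier = at-most-three , three-orders
  where
  open PlusOneDigraph 2≤k G outlier using (non-maximal-order)

  bottom-two : ∀ {x y z r s t} → IsOrder o x r → IsOrder o y s → IsOrder o z t →
               r < s → s < t → r ≡ 2 × s ≡ k + 2
  bottom-two ordˣ ordʸ ordᶻ r<s s<t = <-on-two-values (non-maximal-order minimal ordˣ ordᶻ (<-trans r<s s<t))
                                                      (non-maximal-order minimal ordʸ ordᶻ s<t) (m≤n+m 2 k) r<s

  at-most-three : ∀ v₁ v₂ v₃ v₄ t₁ t₂ t₃ t₄ → IsOrder o v₁ t₁ → IsOrder o v₂ t₂ → IsOrder o v₃ t₃ →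
                  IsOrder o v₄ t₄ → t₁ < t₂ → t₂ < t₃ → t₃ < t₄ → ⊥
  at-most-three _ _ _ _ t₁ t₂ _ _ o₁ o₂ o₃ o₄ t₁<t₂ t₂<t₃ t₃<t₄ = <-irrefl (trans t₁≡2 (sym t₂≡2)) t₁<t₂
    where
    t₁≡2 : t₁ ≡ 2
    t₁≡2 = proj₁ (bottom-two o₁ o₂ o₄ t₁<t₂ (<-trans t₂<t₃ t₃<t₄))
    t₂≡2 : t₂ ≡ 2
    t₂≡2 = proj₁ (bottom-two o₂ o₃ o₄ t₂<t₃ t₃<t₄)

  three-orders : ∀ v₁ v₂ v₃ s₁ s₂ s₃ → IsOrder o v₁ s₁ → IsOrder o v₂ s₂ → IsOrder o v₃ s₃ →
                 s₁ < s₂ → s₂ < s₃ → s₁ ≡ 2 × s₂ ≡ k + 2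
  three-orders _ _ _ _ _ _ = bottom-two
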